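{- Let $n>1$ be an integer and $d>1$ a proper divisor of $n$. Then $\omega(X_n(1,d)) \leqslant f(n)\cdot f\left(\frac{n}{d}\right)$.
   Context: For an integer $n>1$ and a set $D$ of positive proper divisors of $n$, the gcd-graph $X_n(D)$ has vertex set $\mathbb{Z}_n=\{0,1,\ldots,n-1\}$, and two distinct vertices $a,b$ are adjacent if and only if $\gcd(a-b,n)\in D$; $X_n(1,d)$ denotes $X_n(\{1,d\})$. For an integer $m>1$, $f(m)$ denotes the smallest prime divisor of $m$. $\omega$ denotes the clique number. -}

module Defs where

open import Data.Nat using (ℕ; _*_; _≤_; _<_; ∣_-_∣)
open import Data.Nat.Divisibility using (_∣_)
open import Data.Nat.GCD using (gcd)
open import Data.Nat.Primality using (Prime)
open import Data.List using (List; length)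
open import Data.List.Relation.Unary.All using (All)
open import Data.List.Relation.Unary.AllPairs using (AllPairs)
open import Data.Sum using (_⊎_)
open import Data.Product using (_×_)
open import Relation.Binary.PropositionalEquality using (_≡_)
open import Relation.Nullary using (¬_)

IsSmallestPrimeDivisor : ℕ → ℕ → Set
IsSmallestPrimeDivisor p m = Prime p × p ∣ m × (∀ q → Prime q → q ∣ m → p ≤ q)

Adj1d : ℕ → ℕ → ℕ → ℕ → Set
Adj1d n d a b = ¬ (a ≡ b) × (gcd ∣ a - b ∣ n ≡ 1 ⊎ gcd ∣ a - b ∣ n ≡ d)

-- a clique of X_n(1,d): a list of vertices of Z_n that are pairwise adjacent
-- (adjacency includes distinctness, so the list has no repetitions)
IsClique1d : ℕ → ℕ → List ℕ → Set
IsClique1d n d vs = All (_< n) vs × AllPairs (Adj1d n d) vs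

-- Map a vertex a to the residue pair (a mod p, ⌊a/d⌋ mod q), with p ∣ n and q ∣ n/d both
-- larger than 1.  Adjacent vertices get different pairs: equal first components give
-- p ∣ gcd(a − b, n), so the gcd is not 1 and must be d; then d ∣ a − b, so equal second
-- components give dq ∣ gcd(a − b, n) = d, which is absurd.  A clique therefore injects into
-- a set of p·q residue pairs.
module Submission where

open import Defs
open import Data.Nat using (ℕ; _*_; _≤_; _<_)
open import Data.Nat.Divisibility using (_∣_)
open import Data.List using (List; length)
open import Relation.Binary.PropositionalEquality using (_≡_)

open import Data.Nat.Base using (_+_; _∸_; ∣_-_∣; NonZero; >-nonZero; nonTrivial⇒n>1; z<s)
open import Data.Nat.Properties
open import Data.Nat.DivMod
open import Data.Nat.Divisibility using (divides; ∣⇒≤; ∣1⇒≡1; *-monoˡ-∣)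
open import Data.Nat.GCD using (gcd; gcd-greatest; gcd[m,n]∣m)
open import Data.Nat.Primality using (prime⇒nonZero; prime⇒nonTrivial)
open import Data.Fin.Base using (Fin; zero; suc; toℕ; combine; remQuot)
open import Data.Fin.Properties using (injective⇒≤; toℕ-fromℕ<; remQuot-combine)
open import Data.List.Base using (_∷_; lookup)
open import Data.List.Membership.Propositional.Properties using (∈-lookup)
import Data.List.Relation.Unary.All as All
open import Data.List.Relation.Unary.AllPairs using (AllPairs; _∷_)
import Data.List.Relation.Unary.AllPairs as AllPairs
open import Data.Product.Base using (_×_; _,_)
open import Data.Product.Properties using (,-injectiveˡ; ,-injectiveʳ)
open import Data.Sum.Base using (inj₁; inj₂)
open import Data.Empty using (⊥-elim)
open import Function.Base using (_on_)
open import Relation.Binary.PropositionalEquality using (_≢_; refl; sym; trans; cong; cong₂; subst; module ≡-Reasoning)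

module _ {a} {A : Set a} {m : ℕ} (f : A → Fin m) where

  AllPairs-≢-on⇒lookup-injective : ∀ {xs} → AllPairs (_≢_ on f) xs →
    ∀ i j → f (lookup xs i) ≡ f (lookup xs j) → i ≡ j
  AllPairs-≢-on⇒lookup-injective (_  ∷ _)   zero    zero    _  = refl
  AllPairs-≢-on⇒lookup-injective (px ∷ _)   zero    (suc j) eq = ⊥-elim (All.lookup px (∈-lookup j) eq)
  AllPairs-≢-on⇒lookup-injective (px ∷ _)   (suc i) zero    eq = ⊥-elim (All.lookup px (∈-lookup i) (sym eq))
  AllPairs-≢-on⇒lookup-injective (_  ∷ pxs) (suc i) (suc j) eq =
    cong suc (AllPairs-≢-on⇒lookup-injective pxs i j eq)

  AllPairs-≢-on⇒length≤ : ∀ {xs} → AllPairs (_≢_ on f) xs → length xs ≤ m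
  AllPairs-≢-on⇒length≤ {xs} pxs =
    injective⇒≤ {f = λ i → f (lookup xs i)} (AllPairs-≢-on⇒lookup-injective pxs _ _)

%-cong⇒∣m-n∣≡∣m/o-n/o∣*o : ∀ {o m n} .{{_ : NonZero o}} →
  m % o ≡ n % o → ∣ m - n ∣ ≡ ∣ m / o - n / o ∣ * o
%-cong⇒∣m-n∣≡∣m/o-n/o∣*o {o} {m} {n} eq = begin
  ∣ m - n ∣                                  ≡⟨ cong₂ ∣_-_∣ (m≡m%n+[m/n]*n m o) (m≡m%n+[m/n]*n n o) ⟩
  ∣ m % o + m / o * o - n % o + n / o * o ∣  ≡⟨ cong (λ r → ∣ m % o + m / o * o - r + n / o * o ∣) eq ⟨
  ∣ m % o + m / o * o - m % o + n / o * o ∣  ≡⟨ ∣m+n-m+o∣≡∣n-o∣ (m % o) (m / o * o) (n / o * o) ⟩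
  ∣ m / o * o - n / o * o ∣                  ≡⟨ *-distribʳ-∣-∣ o (m / o) (n / o) ⟨
  ∣ m / o - n / o ∣ * o                      ∎
  where open ≡-Reasoning

%-cong⇒∣∣m-n∣ : ∀ {o m n} .{{_ : NonZero o}} → m % o ≡ n % o → o ∣ ∣ m - n ∣
%-cong⇒∣∣m-n∣ {o} {m} {n} eq = divides ∣ m / o - n / o ∣ (%-cong⇒∣m-n∣≡∣m/o-n/o∣*o eq)

private
  ≥∧∣∣m-n∣⇒%-cong : ∀ {o m n} .{{_ : NonZero o}} → n ≤ m → o ∣ ∣ m - n ∣ → m % o ≡ n % o
  ≥∧∣∣m-n∣⇒%-cong {o} {m} {n} n≤m o∣m-n = begin
    m % o              ≡⟨ cong (_% o) (m+[n∸m]≡n n≤m) ⟨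
    (n + (m ∸ n)) % o  ≡⟨ %-remove-+ʳ n (subst (o ∣_) (m≤n⇒∣n-m∣≡n∸m n≤m) o∣m-n) ⟩
    n % o              ∎
    where open ≡-Reasoning

∣∣m-n∣⇒%-cong : ∀ {o m n} .{{_ : NonZero o}} → o ∣ ∣ m - n ∣ → m % o ≡ n % o
∣∣m-n∣⇒%-cong {o} {m} {n} o∣m-n with ≤-total n m
... | inj₁ n≤m = ≥∧∣∣m-n∣⇒%-cong n≤m o∣m-n
... | inj₂ m≤n = sym (≥∧∣∣m-n∣⇒%-cong m≤n (subst (o ∣_) (∣-∣-comm m n) o∣m-n))

%-cong∧/%-cong⇒∣∣m-n∣ : ∀ {o q m n} .{{_ : NonZero o}} .{{_ : NonZero q}} →
  m % o ≡ n % o → m / o % q ≡ n / o % q → q * o ∣ ∣ m - n ∣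
%-cong∧/%-cong⇒∣∣m-n∣ {o} {q} eq eq/ =
  subst (q * o ∣_) (sym (%-cong⇒∣m-n∣≡∣m/o-n/o∣*o eq)) (*-monoˡ-∣ o (%-cong⇒∣∣m-n∣ eq/))

mod-cong⇒%-cong : ∀ {o m n} .{{_ : NonZero o}} → m mod o ≡ n mod o → m % o ≡ n % o
mod-cong⇒%-cong {o} {m} {n} eq = begin
  m % o          ≡⟨ toℕ-fromℕ< (m%n<n m o) ⟨
  toℕ (m mod o)  ≡⟨ cong toℕ eq ⟩
  toℕ (n mod o)  ≡⟨ toℕ-fromℕ< (m%n<n n o) ⟩
  n % o          ∎
  where open ≡-Reasoning

residueCode : (p q d : ℕ) .{{_ : NonZero p}} .{{_ : NonZero q}} .{{_ : NonZero d}} → ℕ → Fin (p * q)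
residueCode p q d a = combine (a mod p) (a / d mod q)

residueCode-injective : ∀ {p q d a b} .{{_ : NonZero p}} .{{_ : NonZero q}} .{{_ : NonZero d}} →
  residueCode p q d a ≡ residueCode p q d b → a % p ≡ b % p × a / d % q ≡ b / d % q
residueCode-injective {p} {q} {d} {a} {b} eq =
  mod-cong⇒%-cong (,-injectiveˡ residues≡) , mod-cong⇒%-cong (,-injectiveʳ residues≡)
  where
  residues≡ : (a mod p , a / d mod q) ≡ (b mod p , b / d mod q)
  residues≡ = begin
    (a mod p , a / d mod q)          ≡⟨ remQuot-combine (a mod p) (a / d mod q) ⟨
    remQuot q (residueCode p q d a)  ≡⟨ cong (remQuot q) eq ⟩
    remQuot q (residueCode p q d b)  ≡⟨ remQuot-combine (b mod p) (b / d mod q) ⟩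
    (b mod p , b / d mod q)          ∎
    where open ≡-Reasoning

Adj1d⇒residueCode≢ : ∀ {n d p q a b} .{{_ : NonZero p}} .{{_ : NonZero q}} .{{_ : NonZero d}} →
  1 < p → p ∣ n → 1 < q → q * d ∣ n →
  Adj1d n d a b → residueCode p q d a ≢ residueCode p q d b
Adj1d⇒residueCode≢ {n} {d} {p} {q} {a} {b} 1<p p∣n 1<q qd∣n (_ , gcd≡1∨gcd≡d) eq
  with residueCode-injective eq
... | a≡b[p] , a/d≡b/d[q] with gcd≡1∨gcd≡d
...   | inj₁ gcd≡1 = >⇒≢ 1<p (∣1⇒≡1 (subst (p ∣_) gcd≡1 p∣gcd))
  where
  p∣gcd : p ∣ gcd (∣ a - b ∣) n
  p∣gcd = gcd-greatest (%-cong⇒∣∣m-n∣ a≡b[p]) p∣n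
...   | inj₂ gcd≡d = <⇒≱ d<qd (∣⇒≤ (subst (q * d ∣_) gcd≡d qd∣gcd))
  where
  a≡b[d] : a % d ≡ b % d
  a≡b[d] = ∣∣m-n∣⇒%-cong (subst (_∣ ∣ a - b ∣) gcd≡d (gcd[m,n]∣m ∣ a - b ∣ n))
  qd∣gcd : q * d ∣ gcd (∣ a - b ∣) n
  qd∣gcd = gcd-greatest (%-cong∧/%-cong⇒∣∣m-n∣ a≡b[d] a/d≡b/d[q]) qd∣n
  d<qd : d < q * d
  d<qd = subst (d <_) (*-comm d q) (m<m*n d q 1<q)

lemma3p2 : (n d e p q : ℕ) → 1 < n → 1 < d → d < n → n ≡ d * e →
    IsSmallestPrimeDivisor p n → IsSmallestPrimeDivisor q e →
    (vs : List ℕ) → IsClique1d n d vs → length vs ≤ p * q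
lemma3p2 n d e p q _ 1<d _ n≡de (p-prime , p∣n , _) (q-prime , q∣e , _) vs (_ , clique) =
  AllPairs-≢-on⇒length≤ (residueCode p q d)
    (AllPairs.map (Adj1d⇒residueCode≢ 1<p p∣n 1<q qd∣n) clique)
  where
  instance
    _ : NonZero p
    _ = prime⇒nonZero p-prime
    _ : NonZero q
    _ = prime⇒nonZero q-prime
    _ : NonZero d
    _ = >-nonZero (<-trans z<s 1<d)
  1<p : 1 < p
  1<p = nonTrivial⇒n>1 p {{prime⇒nonTrivial p-prime}}
  1<q : 1 < q
  1<q = nonTrivial⇒n>1 q {{prime⇒nonTrivial q-prime}}
  qd∣n : q * d ∣ n
  qd∣n = subst (q * d ∣_) (trans (*-comm e d) (sym n≡de)) (*-monoˡ-∣ d q∣e)
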